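{- Let $J_1$ and $J_2$ be two graphs, $L_1\subseteq V(J_1)$, $L_2\subseteq V(J_2)$, and $S$ a finite set. Then in $R^\circ_S$, \[ \tilde{k}(J_1,L_1,S;x,y)\,\tilde{k}(J_2,L_2,S;x,y) = \sum_{I\subseteq V(J_1)}\ \sum_{\lambda \in \mathrm{inj}(I,V(J_2)) } \tilde{k}(J_{I,\lambda},L_{I,\lambda},S;x,y),\] where the graph $J_{I,\lambda}$ and the subset $L_{I,\lambda}$ of its vertex set are produced as follows: start with the disjoint union of $J_1$ and $J_2$, where the vertices of $J_i$ that are in $L_i$ are colored blue and the other ones red. Then identify $v$ in $J_1$ with $\lambda(v)$ in $J_2$ for all $v\in I$; if $v$ and $\lambda(v)$ had the same color before their identification the identified vertex is red, and otherwise it is blue. If there are any double edges after the identifications, then both of the edges are removed. The resulting graph is $J_{I,\lambda}$ and the blue vertices form $L_{I,\lambda}$.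
   Context: All graphs are finite and simple. For a finite set $S$, $E(K_S)$ is the set of 2-element subsets of $S$, $R_S=\mathbb{R}[x_e \mid e\in E(K_S)]/\langle x_e^2-1\rangle$ (write $x_{ab}$ for $x_{\{a,b\}}$), and $R^\circ_S=R_S[y_v\mid v\in S]/\langle y_v^2-1\mid v\in S\rangle$. $\mathrm{inj}(A,B)$ is the set of injective maps $A\to B$; for an injection $\phi$ and edge $e=uv$, $x_{\phi(e)}$ means $x_{\phi(u)\phi(v)}$. For a graph $J$, $L\subseteq V(J)$ and set $S$, \[ \tilde{k}(J,L,S;x,y) = \sum_{\phi \in \mathrm{inj}(V(J),S)} \prod_{e\in E(J)} x_{\phi(e)} \prod_{u\in L}y_{\phi(u)}\in R^\circ_S. \] -}

module Defs where

open import Data.Bool using (Bool; true; false; _xor_; _∧_; _∨_; not; if_then_else_)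
open import Data.Nat using (ℕ; zero; suc; _<ᵇ_; _≡ᵇ_)
import Data.Nat
import Data.Product
open import Data.Fin using (Fin; toℕ)
import Data.Fin as F
open import Data.Vec using (Vec; []; _∷_; lookup)
open import Data.List using (List; []; _∷_; map; concatMap; concat; foldr; length; _++_; allFin)
import Data.List as L
open import Data.Maybe using (Maybe; just; nothing)
open import Data.Sum using (_⊎_; inj₁; inj₂)
open import Data.Product using (_×_; _,_)
open import Relation.Binary.PropositionalEquality using (_≡_)
open import Relation.Nullary.Decidable using (⌊_⌋)

eqF : ∀ {n} → Fin n → Fin n → Bool
eqF a b = ⌊ a F.≟ b ⌋

ltF : ∀ {n} → Fin n → Fin n → Bool
ltF a b = toℕ a <ᵇ toℕ b

eqB : Bool → Bool → Bool
eqB a b = not (a xor b)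

allB : (n : ℕ) → (Fin n → Bool) → Bool
allB n f = foldr (λ i b → f i ∧ b) true (allFin n)

anyB : (n : ℕ) → (Fin n → Bool) → Bool
anyB n f = foldr (λ i b → f i ∨ b) false (allFin n)

findB : (n : ℕ) → (Fin n → Bool) → Maybe (Fin n)
findB n f = foldr (λ i r → if f i then just i else r) nothing (allFin n)

filterB : ∀ {A : Set} → (A → Bool) → List A → List A
filterB p [] = []
filterB p (x ∷ xs) = if p x then x ∷ filterB p xs else filterB p xs

countB : ∀ {A : Set} → (A → Bool) → List A → ℕ
countB p xs = length (filterB p xs)

xorAll : List Bool → Bool
xorAll = foldr _xor_ false

vecs : ∀ {A : Set} → List A → (m : ℕ) → List (Vec A m)
vecs xs zero = [] ∷ []
vecs xs (suc m) = concatMap (λ v → map (_∷ v) xs) (vecs xs m)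

-- Since x_e^2 = 1 and y_v^2 = 1, R°_S is the real group algebra of
-- (Z/2)^(E(K_S) ⊔ S): a monomial is a squarefree monomial, i.e. an
-- exponent vector mod 2.  The edge exponent of x_{cd} is read at (c,d)
-- with c < d (unordered pairs).

record Mono (n : ℕ) : Set where
  constructor mono
  field
    ex : Fin n → Fin n → Bool
    ey : Fin n → Bool
open Mono public

oneM : ∀ {n} → Mono n
oneM = mono (λ _ _ → false) (λ _ → false)

_·_ : ∀ {n} → Mono n → Mono n → Mono n
m₁ · m₂ = mono (λ c d → ex m₁ c d xor ex m₂ c d) (λ c → ey m₁ c xor ey m₂ c)

prodM : ∀ {n} → List (Mono n) → Mono n
prodM = foldr _·_ oneM

xvar : ∀ {n} → Fin n → Fin n → Mono n
xvar a b = mono (λ c d → (eqF c a ∧ eqF d b) ∨ (eqF c b ∧ eqF d a)) (λ _ → false)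

yvar : ∀ {n} → Fin n → Mono n
yvar a = mono (λ _ _ → false) (λ c → eqF c a)

_==ᴹ_ : ∀ {n} → Mono n → Mono n → Bool
_==ᴹ_ {n} m₁ m₂ =
  allB n (λ c → allB n (λ d → not (ltF c d) ∨ eqB (ex m₁ c d) (ex m₂ c d)))
  ∧ allB n (λ c → eqB (ey m₁ c) (ey m₂ c))

-- Elements of R°_S with nonnegative integer coefficients, as formal sums
-- of monomials (each list entry contributes coefficient 1).
Poly : ℕ → Set
Poly n = List (Mono n)

coeff : ∀ {n} → Poly n → Mono n → ℕ
coeff p μ = countB (λ ν → ν ==ᴹ μ) p

_≈_ : ∀ {n} → Poly n → Poly n → Set
p ≈ q = ∀ μ → coeff p μ ≡ coeff q μ

_⊗_ : ∀ {n} → Poly n → Poly n → Poly n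
p ⊗ q = concatMap (λ a → map (a ·_) q) p

record Graph : Set where
  field
    size    : ℕ
    adj     : Fin size → Fin size → Bool
    adj-sym : ∀ u v → adj u v ≡ adj v u
    adj-irr : ∀ u → adj u u ≡ false
open Graph public

edgesOf : (m : ℕ) → (Fin m → Fin m → Bool) → List (Fin m × Fin m)
edgesOf m a = concatMap (λ u → concatMap (λ v →
  if ltF u v ∧ a u v then (u , v) ∷ [] else []) (allFin m)) (allFin m)

injB : ∀ {m n} → Vec (Fin n) m → Bool
injB {m} φ = allB m (λ i → allB m (λ j → not (eqF (lookup φ i) (lookup φ j)) ∨ eqF i j))

injs : (m n : ℕ) → List (Vec (Fin n) m)
injs m n = filterB injB (vecs (allFin n) m)

kRaw : (n m : ℕ) → (Fin m → Fin m → Bool) → (Fin m → Bool) → Poly n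
kRaw n m a L = map (λ φ →
    prodM (map (λ e → xvar (lookup φ (Data.Product.proj₁ e)) (lookup φ (Data.Product.proj₂ e))) (edgesOf m a))
  · prodM (map (λ u → yvar (lookup φ u)) (filterB L (allFin m)))) (injs m n)

ktilde : (J : Graph) → (Fin (size J) → Bool) → (n : ℕ) → Poly n
ktilde J L n = kRaw n (size J) (adj J) L

-- Pairs (I, λ) with I ⊆ V(J₁), λ ∈ inj(I, V(J₂)), encoded as partial
-- injective maps Fin m₁ → Maybe (Fin m₂) (I = domain of definition).

bothEq : ∀ {m} → Maybe (Fin m) → Maybe (Fin m) → Bool
bothEq (just a) (just b) = eqF a b
bothEq _ _ = false

pinjB : ∀ {m₁ m₂} → Vec (Maybe (Fin m₂)) m₁ → Bool
pinjB {m₁} λ' = allB m₁ (λ i → allB m₁ (λ j → not (bothEq (lookup λ' i) (lookup λ' j)) ∨ eqF i j))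

pinjs : (m₁ m₂ : ℕ) → List (Vec (Maybe (Fin m₂)) m₁)
pinjs m₁ m₂ = filterB pinjB (vecs (nothing ∷ map just (allFin m₂)) m₁)

module Merge (J₁ J₂ : Graph) (L₁ : Fin (size J₁) → Bool) (L₂ : Fin (size J₂) → Bool)
             (λ' : Vec (Maybe (Fin (size J₂))) (size J₁)) where

  m₁ = size J₁
  m₂ = size J₂

  V : Set
  V = Fin m₁ ⊎ Fin m₂

  eqV : V → V → Bool
  eqV (inj₁ a) (inj₁ b) = eqF a b
  eqV (inj₂ a) (inj₂ b) = eqF a b
  eqV _ _ = false

  isImg : Fin m₂ → Bool
  isImg w = anyB m₁ (λ v → bothEq (lookup λ' v) (just w))

  ι₁ : Fin m₁ → V
  ι₁ = inj₁

  ι₂ : Fin m₂ → V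
  ι₂ w with findB m₁ (λ v → bothEq (lookup λ' v) (just w))
  ... | just v  = inj₁ v
  ... | nothing = inj₂ w

  -- vertices of J_{I,λ}: V(J₁) together with V(J₂) ∖ λ(I)
  vlist : List V
  vlist = map inj₁ (allFin m₁) ++ map inj₂ (filterB (λ w → not (isImg w)) (allFin m₂))

  size' : ℕ
  size' = length vlist

  lab : Fin size' → V
  lab = L.lookup vlist

  samePair : V → V → V → V → Bool
  samePair p q c d = (eqV p c ∧ eqV q d) ∨ (eqV p d ∧ eqV q c)

  mult : V → V → ℕ
  mult c d =
      countB (λ e → samePair (ι₁ (Data.Product.proj₁ e)) (ι₁ (Data.Product.proj₂ e)) c d) (edgesOf m₁ (adj J₁))
    Data.Nat.+ countB (λ e → samePair (ι₂ (Data.Product.proj₁ e)) (ι₂ (Data.Product.proj₂ e)) c d) (edgesOf m₂ (adj J₂))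

  -- an edge survives iff it is not doubled
  adj' : Fin size' → Fin size' → Bool
  adj' a b = mult (lab a) (lab b) ≡ᵇ 1

  -- blue iff the identified colours differ (XOR of the blue indicators)
  L' : Fin size' → Bool
  L' a = xorAll
    (   map L₁ (filterB (λ u → eqV (ι₁ u) (lab a)) (allFin m₁))
     ++ map L₂ (filterB (λ w → eqV (ι₂ w) (lab a)) (allFin m₂)))

  kMerged : (n : ℕ) → Poly n
  kMerged n = kRaw n size' adj' L'

kSum : (J₁ J₂ : Graph) (L₁ : Fin (size J₁) → Bool) (L₂ : Fin (size J₂) → Bool) (n : ℕ) → Poly n
kSum J₁ J₂ L₁ L₂ n = concatMap (λ λ' → Merge.kMerged J₁ J₂ L₁ L₂ λ' n) (pinjs (size J₁) (size J₂))

module Submission where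

-- Both sides are formal sums of squarefree monomials, so it suffices to show
-- that every monomial μ occurs equally often on both sides.  Expanding the
-- product, μ is counted over pairs (φ₁,φ₂) of injections V(J₁) → S and
-- V(J₂) → S.  Each pair has an overlap pattern: the partial injection λ
-- sending v ∈ V(J₁) to the w ∈ V(J₂) with φ₂(w) = φ₁(v), where it exists.
-- Grouping the pairs by their pattern turns the count into a sum over all
-- partial injections λ.  For a fixed λ, the pairs with pattern λ correspond
-- bijectively to the injections ψ of the glued vertex set V(J_{I,λ}) into S,
-- and the monomial of (φ₁,φ₂) is the monomial of ψ in k̃(J_{I,λ},L_{I,λ},S):
-- x_{cd} occurs with the parity of the number of edges of J₁ ⊔ J₂ sent onto
-- {c,d}, which is at most one from each graph and so is odd exactly when the
-- glued pair carries exactly one edge (double edges cancel); y_c occurs with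
-- the parity of the blue vertices sent to c, which is the XOR colour rule.

open import Data.Bool using (Bool; true; false; _xor_; _∧_; _∨_; not; if_then_else_)
open import Data.Bool.Properties
  using (xor-identityʳ; xor-assoc; ∧-comm; ∧-identityʳ; ∧-zeroʳ; ∨-comm; ∨-zeroʳ; ¬-not; not-involutive; T-≡)
open import Data.Nat using (ℕ; zero; suc; _+_; _≤_; _<_; z≤n; s≤s; _≡ᵇ_)
import Data.Nat.Properties as NP
open import Data.Nat.ListAction using (sum)
open import Data.Nat.ListAction.Properties using (sum-++; sum-↭)
open import Algebra.Properties.CommutativeSemigroup NP.+-commutativeSemigroup using (interchange)
open import Data.Fin using (Fin; toℕ)
import Data.Fin as F
import Data.Fin.Properties as FP
open import Data.List using (List; []; _∷_; map; concatMap; foldr; _++_; allFin; cartesianProduct)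
import Data.List as L
open import Data.List.Properties using (map-++; map-∘)
open import Data.Maybe using (Maybe; just; nothing)
open import Data.Maybe.Properties using (just-injective)
import Data.Maybe.Properties as MP
open import Data.Product using (_×_; _,_; proj₁; proj₂; ∃)
open import Data.Sum using (_⊎_; inj₁; inj₂)
import Data.Sum.Properties as SP
open import Data.Vec using (Vec; lookup; tabulate) renaming ([] to []ᵥ; _∷_ to _∷ᵥ_)
open import Data.Vec.Properties using (lookup∘tabulate; tabulate∘lookup; tabulate-cong)
import Data.Vec.Properties as VP
open import Data.Empty using (⊥; ⊥-elim)
open import Function.Base using (_∘_; _∋_)
open import Function.Bundles using (mk⇔; Equivalence)
open import Relation.Nullary using (yes; no)
open import Relation.Nullary.Decidable using (Dec; ⌊_⌋; dec-true; dec-false; isYes≗does)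
open import Relation.Binary.Definitions using (DecidableEquality; tri<; tri≈; tri>)
open import Relation.Binary.PropositionalEquality
open import Data.List.Relation.Unary.All as All using ([]; _∷_)
open import Data.List.Relation.Unary.AllPairs using ([]; _∷_)
open import Data.List.Relation.Unary.Any using (here; there; index)
open import Data.List.Relation.Unary.Any.Properties using (lookup-index)
open import Data.List.Relation.Unary.Unique.Propositional using (Unique)
open import Data.List.Relation.Unary.Unique.Propositional.Properties
  using (++⁺; allFin⁺; cartesianProduct⁺) renaming (map⁺ to map-unique⁺)
open import Data.List.Membership.Propositional using (_∈_; find; lose)
open import Data.List.Membership.Propositional.Properties
  using (∈-++⁺ˡ; ∈-++⁺ʳ; ∈-++⁻; ∈-concatMap⁺; ∈-concatMap⁻; ∈-map⁺; ∈-map⁻; ∈-allFin; ∈-lookup; ∈-cartesianProduct⁺; ∈-cartesianProduct⁻)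
open import Data.List.Membership.Propositional.Properties.WithK using (unique∧set⇒bag)
open import Data.List.Relation.Binary.BagAndSetEquality using (∼bag⇒↭)
open import Data.List.Relation.Binary.Permutation.Propositional using (_↭_)
open import Data.List.Relation.Binary.Permutation.Propositional.Properties using () renaming (map⁺ to ↭-map⁺)
open import Defs

ind : Bool → ℕ
ind true = 1
ind false = 0

∑ : ∀ {A : Set} → (A → ℕ) → List A → ℕ
∑ f xs = sum (map f xs)

module _ {A : Set} where

  countB-∑ : (p : A → Bool) (xs : List A) → countB p xs ≡ ∑ (ind ∘ p) xs
  countB-∑ p [] = refl
  countB-∑ p (x ∷ xs) with p x
  ... | true = cong suc (countB-∑ p xs)
  ... | false = countB-∑ p xs

  ∑-++ : (f : A → ℕ) (xs ys : List A) → ∑ f (xs ++ ys) ≡ ∑ f xs + ∑ f ys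
  ∑-++ f xs ys = trans (cong sum (map-++ f xs ys)) (sum-++ (map f xs) (map f ys))

  ∑-cong : {f g : A → ℕ} (xs : List A) → (∀ {x} → x ∈ xs → f x ≡ g x) → ∑ f xs ≡ ∑ g xs
  ∑-cong [] h = refl
  ∑-cong (x ∷ xs) h = cong₂ _+_ (h (here refl)) (∑-cong xs (h ∘ there))

  ∑-ext : {f g : A → ℕ} (xs : List A) → (∀ x → f x ≡ g x) → ∑ f xs ≡ ∑ g xs
  ∑-ext xs h = ∑-cong xs (λ {x} _ → h x)

  ∑-+ : (f g : A → ℕ) (xs : List A) → ∑ (λ x → f x + g x) xs ≡ ∑ f xs + ∑ g xs
  ∑-+ f g [] = refl
  ∑-+ f g (x ∷ xs) =
    trans (cong (f x + g x +_) (∑-+ f g xs)) (interchange (f x) (g x) (∑ f xs) (∑ g xs))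

  ∑-zero : (f : A → ℕ) (xs : List A) → (∀ {x} → x ∈ xs → f x ≡ 0) → ∑ f xs ≡ 0
  ∑-zero f [] h = refl
  ∑-zero f (x ∷ xs) h = cong₂ _+_ (h (here refl)) (∑-zero f xs (h ∘ there))

  ∑-point : (f : A → ℕ) (xs : List A) (x₀ : A) → Unique xs → x₀ ∈ xs →
            (∀ {x} → x ∈ xs → x ≢ x₀ → f x ≡ 0) → ∑ f xs ≡ f x₀
  ∑-point f (x ∷ xs) x₀ (x∉ ∷ u) (here refl) h =
    trans (cong (f x +_) (∑-zero f xs (λ m → h (there m) (λ e → All.lookup x∉ m (sym e)))))
          (NP.+-identityʳ _)
  ∑-point f (x ∷ xs) x₀ (x∉ ∷ u) (there m₀) h =
    cong₂ _+_ (h (here refl) (λ e → All.lookup x∉ (subst (_∈ xs) (sym e) m₀) refl))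
              (∑-point f xs x₀ u m₀ (h ∘ there))

  ∑-↭ : (f : A → ℕ) {xs ys : List A} → xs ↭ ys → ∑ f xs ≡ ∑ f ys
  ∑-↭ f p = sum-↭ (↭-map⁺ f p)

countB-ext : ∀ {A : Set} {p q : A → Bool} (xs : List A) → (∀ x → p x ≡ q x) → countB p xs ≡ countB q xs
countB-ext {p = p} {q} xs h =
  trans (countB-∑ p xs) (trans (∑-ext xs (λ x → cong ind (h x))) (sym (countB-∑ q xs)))

module _ {A B : Set} where

  ∑-map : (f : B → ℕ) (g : A → B) (xs : List A) → ∑ f (map g xs) ≡ ∑ (f ∘ g) xs
  ∑-map f g xs = cong sum (sym (map-∘ xs))

  ∑-concatMap : (f : B → ℕ) (g : A → List B) (xs : List A) →
                ∑ f (concatMap g xs) ≡ ∑ (λ x → ∑ f (g x)) xs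
  ∑-concatMap f g [] = refl
  ∑-concatMap f g (x ∷ xs) =
    trans (∑-++ f (g x) (concatMap g xs)) (cong (∑ f (g x) +_) (∑-concatMap f g xs))


∑-cartesianProduct : ∀ {A B : Set} (f : A × B → ℕ) (xs : List A) (ys : List B) →
                     ∑ f (cartesianProduct xs ys) ≡ ∑ (λ x → ∑ (λ y → f (x , y)) ys) xs
∑-cartesianProduct f [] ys = refl
∑-cartesianProduct f (x ∷ xs) ys =
  trans (∑-++ f (map (x ,_) ys) _) (cong₂ _+_ (∑-map f (x ,_) ys) (∑-cartesianProduct f xs ys))

module _ {A : Set} where

  filterB-∈⁻ : (p : A → Bool) {xs : List A} {x : A} → x ∈ filterB p xs → x ∈ xs × p x ≡ true
  filterB-∈⁻ p {y ∷ xs} m with p y in py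
  filterB-∈⁻ p {y ∷ xs} (here refl) | true = here refl , py
  filterB-∈⁻ p {y ∷ xs} (there m) | true = let (m' , px) = filterB-∈⁻ p m in there m' , px
  ... | false = let (m' , px) = filterB-∈⁻ p m in there m' , px

  filterB-∈⁺ : (p : A → Bool) {xs : List A} {x : A} → x ∈ xs → p x ≡ true → x ∈ filterB p xs
  filterB-∈⁺ p {y ∷ xs} (here refl) px rewrite px = here refl
  filterB-∈⁺ p {y ∷ xs} (there m) px with p y
  ... | true = there (filterB-∈⁺ p m px)
  ... | false = filterB-∈⁺ p m px

  filterB-unique : (p : A → Bool) {xs : List A} → Unique xs → Unique (filterB p xs)
  filterB-unique p {[]} u = []
  filterB-unique p {x ∷ xs} (x∉ ∷ u) with p x
  ... | true = All.tabulate (λ m → All.lookup x∉ (proj₁ (filterB-∈⁻ p m))) ∷ filterB-unique p u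
  ... | false = filterB-unique p u

  lookup-inj : (xs : List A) → Unique xs → ∀ {i j} → L.lookup xs i ≡ L.lookup xs j → i ≡ j
  lookup-inj (x ∷ xs) (x∉ ∷ u) {F.zero} {F.zero} e = refl
  lookup-inj (x ∷ xs) (x∉ ∷ u) {F.zero} {F.suc j} e = ⊥-elim (All.lookup x∉ (∈-lookup j) e)
  lookup-inj (x ∷ xs) (x∉ ∷ u) {F.suc i} {F.zero} e = ⊥-elim (All.lookup x∉ (∈-lookup i) (sym e))
  lookup-inj (x ∷ xs) (x∉ ∷ u) {F.suc i} {F.suc j} e = cong F.suc (lookup-inj xs u e)

map-unique : ∀ {A B : Set} (g : A → B) (xs : List A) → Unique xs →
             (∀ {x y} → x ∈ xs → y ∈ xs → g x ≡ g y → x ≡ y) → Unique (map g xs)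
map-unique g [] u h = []
map-unique g (x ∷ xs) (x∉ ∷ u) h =
  All.tabulate (λ m gx≡z → let (y , my , e) = ∈-map⁻ g m in
                           All.lookup x∉ my (h (here refl) (there my) (trans gx≡z e)))
  ∷ map-unique g xs u (λ a b → h (there a) (there b))

⌊⌋-true : ∀ {P : Set} (a? : Dec P) → P → ⌊ a? ⌋ ≡ true
⌊⌋-true a? p = trans (isYes≗does a?) (dec-true a? p)

⌊⌋-false : ∀ {P : Set} (a? : Dec P) → (P → ⊥) → ⌊ a? ⌋ ≡ false
⌊⌋-false a? ¬p = trans (isYes≗does a?) (dec-false a? ¬p)

∑-bijection : ∀ {A B : Set} (xs : List A) (ys : List B) (G : B → A) (F : A → B) →
  Unique xs → Unique ys →
  (∀ {y} → y ∈ ys → G y ∈ xs) → (∀ {y} → y ∈ ys → F (G y) ≡ y) →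
  (∀ {x} → x ∈ xs → F x ∈ ys) → (∀ {x} → x ∈ xs → G (F x) ≡ x) →
  ∀ h → ∑ h xs ≡ ∑ (h ∘ G) ys
∑-bijection xs ys G F ux uy G∈ FG F∈ GF h = trans (∑-↭ h xs↭Gys) (∑-map h G ys)
  where
   unique-Gys : Unique (map G ys)
   unique-Gys = map-unique G ys uy (λ a b e → trans (sym (FG a)) (trans (cong F e) (FG b)))
   to : ∀ {x} → x ∈ xs → x ∈ map G ys
   to m = subst (_∈ map G ys) (GF m) (∈-map⁺ G (F∈ m))
   from : ∀ {x} → x ∈ map G ys → x ∈ xs
   from m = let (y , my , e) = ∈-map⁻ G m in subst (_∈ xs) (sym e) (G∈ my)
   xs↭Gys : xs ↭ map G ys
   xs↭Gys = ∼bag⇒↭ (unique∧set⇒bag ux unique-Gys (mk⇔ to from))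

∑-group : ∀ {A B : Set} (_≟_ : DecidableEquality B) (Λ : A → B) (ps : List B) (xs : List A) (h : A → ℕ) →
  Unique ps → (∀ {x} → x ∈ xs → Λ x ∈ ps) →
  ∑ h xs ≡ ∑ (λ p → ∑ h (filterB (λ x → ⌊ Λ x ≟ p ⌋) xs)) ps
∑-group _≟_ Λ ps [] h u Λ∈ = sym (∑-zero _ ps (λ _ → refl))
∑-group _≟_ Λ ps (x ∷ xs) h u Λ∈ = begin
    h x + ∑ h xs
      ≡⟨ cong₂ _+_ (sym x-in-its-class) (∑-group _≟_ Λ ps xs h u (Λ∈ ∘ there)) ⟩
    ∑ (contribution x) ps + ∑ (λ p → ∑ h (class p xs)) ps
      ≡⟨ sym (∑-+ _ _ ps) ⟩
    ∑ (λ p → contribution x p + ∑ h (class p xs)) ps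
      ≡⟨ ∑-ext ps (λ p → sym (∑-filterB-∷ p)) ⟩
    ∑ (λ p → ∑ h (class p (x ∷ xs))) ps ∎
  where
    open ≡-Reasoning
    class : _ → List _ → List _
    class p = filterB (λ x → ⌊ Λ x ≟ p ⌋)
    contribution : _ → _ → ℕ
    contribution x p = if ⌊ Λ x ≟ p ⌋ then h x else 0
    ∑-filterB-∷ : ∀ p → ∑ h (class p (x ∷ xs)) ≡ contribution x p + ∑ h (class p xs)
    ∑-filterB-∷ p with ⌊ Λ x ≟ p ⌋
    ... | true = refl
    ... | false = refl
    contribution-off : ∀ {p} → p ∈ ps → p ≢ Λ x → contribution x p ≡ 0
    contribution-off {p} _ p≢ with Λ x ≟ p
    ... | yes e = ⊥-elim (p≢ (sym e))
    ... | no _ = refl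
    x-in-its-class : ∑ (contribution x) ps ≡ h x
    x-in-its-class = trans (∑-point _ ps (Λ x) u (Λ∈ (here refl)) contribution-off)
                           (cong (λ b → if b then h x else 0) (⌊⌋-true (Λ x ≟ Λ x) refl))

par : ℕ → Bool
par zero = false
par (suc n) = not (par n)

xor-++ : (xs ys : List Bool) → xorAll (xs ++ ys) ≡ xorAll xs xor xorAll ys
xor-++ [] ys = refl
xor-++ (x ∷ xs) ys rewrite xor-++ xs ys = sym (xor-assoc x (xorAll xs) (xorAll ys))

module _ {A : Set} where

  xor-filterB : (f p : A → Bool) (xs : List A) →
                xorAll (map f (filterB p xs)) ≡ xorAll (map (λ x → p x ∧ f x) xs)
  xor-filterB f p [] = refl
  xor-filterB f p (x ∷ xs) with p x
  ... | true = cong (f x xor_) (xor-filterB f p xs)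
  ... | false = xor-filterB f p xs

  xor-cong : {f g : A → Bool} (xs : List A) → (∀ {x} → x ∈ xs → f x ≡ g x) →
             xorAll (map f xs) ≡ xorAll (map g xs)
  xor-cong [] h = refl
  xor-cong (x ∷ xs) h = cong₂ _xor_ (h (here refl)) (xor-cong xs (h ∘ there))

  xor-false : (f : A → Bool) (xs : List A) → (∀ {x} → x ∈ xs → f x ≡ false) → xorAll (map f xs) ≡ false
  xor-false f [] h = refl
  xor-false f (x ∷ xs) h rewrite h (here refl) = xor-false f xs (h ∘ there)

  xor-point : (f : A → Bool) (xs : List A) (x₀ : A) → Unique xs → x₀ ∈ xs →
              (∀ {x} → x ∈ xs → x ≢ x₀ → f x ≡ false) → xorAll (map f xs) ≡ f x₀
  xor-point f (x ∷ xs) x₀ (x∉ ∷ u) (here refl) h =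
    trans (cong (f x xor_) (xor-false f xs (λ m → h (there m) (λ e → All.lookup x∉ m (sym e)))))
          (xor-identityʳ _)
  xor-point f (x ∷ xs) x₀ (x∉ ∷ u) (there m₀) h
    rewrite h (here refl) (λ e → All.lookup x∉ (subst (_∈ xs) (sym e) m₀) refl) =
    xor-point f xs x₀ u m₀ (h ∘ there)

  xor-parity : (f : A → Bool) (xs : List A) → xorAll (map f xs) ≡ par (countB f xs)
  xor-parity f [] = refl
  xor-parity f (x ∷ xs) with f x
  ... | true = cong not (xor-parity f xs)
  ... | false = xor-parity f xs

par-sum : ∀ a b → a ≤ 1 → b ≤ 1 → par a xor par b ≡ (a + b ≡ᵇ 1)
par-sum 0 0 _ _ = refl
par-sum 0 1 _ _ = refl
par-sum 1 0 _ _ = refl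
par-sum 1 1 _ _ = refl
par-sum (suc (suc a)) b (s≤s ()) _
par-sum 0 (suc (suc b)) _ (s≤s ())
par-sum 1 (suc (suc b)) _ (s≤s ())

par-ind : ∀ b → par (ind b) ≡ b
par-ind true = refl
par-ind false = refl

ind≤1 : ∀ b → ind b ≤ 1
ind≤1 true = s≤s z≤n
ind≤1 false = z≤n

-- Boolean searches and quantifiers over a list (findB, allB, anyB of Defs
-- are these folds over allFin)

findL : ∀ {A : Set} → (A → Bool) → List A → Maybe A
findL f = foldr (λ i r → if f i then just i else r) nothing

allL : ∀ {A : Set} → (A → Bool) → List A → Bool
allL f = foldr (λ i b → f i ∧ b) true

anyL : ∀ {A : Set} → (A → Bool) → List A → Bool
anyL f = foldr (λ i b → f i ∨ b) false

module _ {A : Set} where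

  findL-just : (f : A → Bool) (xs : List A) {i : A} → findL f xs ≡ just i → f i ≡ true
  findL-just f (x ∷ xs) e with f x in fx
  findL-just f (x ∷ xs) refl | true = fx
  ... | false = findL-just f xs e

  findL-nothing : (f : A → Bool) (xs : List A) → findL f xs ≡ nothing → ∀ {i} → i ∈ xs → f i ≡ false
  findL-nothing f (x ∷ xs) e m with f x in fx
  findL-nothing f (x ∷ xs) () m | true
  findL-nothing f (x ∷ xs) e (here refl) | false = fx
  findL-nothing f (x ∷ xs) e (there m) | false = findL-nothing f xs e m

  findL-unique : (f : A → Bool) (xs : List A) (i₀ : A) → i₀ ∈ xs → f i₀ ≡ true →
                 (∀ {i} → i ∈ xs → f i ≡ true → i ≡ i₀) → findL f xs ≡ just i₀
  findL-unique f (x ∷ xs) i₀ m₀ t h with f x in fx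
  ... | true = cong just (h (here refl) fx)
  findL-unique f (x ∷ xs) i₀ (here refl) t h | false with () ← trans (sym fx) t
  findL-unique f (x ∷ xs) i₀ (there m₀) t h | false = findL-unique f xs i₀ m₀ t (h ∘ there)

  findL-none : (f : A → Bool) (xs : List A) → (∀ {i} → i ∈ xs → f i ≡ false) → findL f xs ≡ nothing
  findL-none f [] h = refl
  findL-none f (x ∷ xs) h rewrite h (here refl) = findL-none f xs (h ∘ there)

  allL-true : (f : A → Bool) (xs : List A) → allL f xs ≡ true → ∀ {i} → i ∈ xs → f i ≡ true
  allL-true f (x ∷ xs) e m with f x in fx
  allL-true f (x ∷ xs) e (here refl) | true = fx
  allL-true f (x ∷ xs) e (there m) | true = allL-true f xs e m
  allL-true f (x ∷ xs) () m | false

  allL-intro : (f : A → Bool) (xs : List A) → (∀ {i} → i ∈ xs → f i ≡ true) → allL f xs ≡ true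
  allL-intro f [] h = refl
  allL-intro f (x ∷ xs) h rewrite h (here refl) = allL-intro f xs (h ∘ there)

  allL-cong : {f g : A → Bool} (xs : List A) → (∀ x → f x ≡ g x) → allL f xs ≡ allL g xs
  allL-cong [] h = refl
  allL-cong (x ∷ xs) h = cong₂ _∧_ (h x) (allL-cong xs h)

  anyL-false : (f : A → Bool) (xs : List A) → anyL f xs ≡ false → ∀ {i} → i ∈ xs → f i ≡ false
  anyL-false f (x ∷ xs) e m with f x in fx
  anyL-false f (x ∷ xs) () m | true
  anyL-false f (x ∷ xs) e (here refl) | false = fx
  anyL-false f (x ∷ xs) e (there m) | false = anyL-false f xs e m

  anyL-intro-false : (f : A → Bool) (xs : List A) → (∀ {i} → i ∈ xs → f i ≡ false) → anyL f xs ≡ false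
  anyL-intro-false f [] h = refl
  anyL-intro-false f (x ∷ xs) h rewrite h (here refl) = anyL-intro-false f xs (h ∘ there)

eqF-sound : ∀ {n} {a b : Fin n} → eqF a b ≡ true → a ≡ b
eqF-sound {a = a} {b} e with a F.≟ b
... | yes p = p

eqF-refl : ∀ {n} (a : Fin n) → eqF a a ≡ true
eqF-refl a = ⌊⌋-true (a F.≟ a) refl

eqF-false : ∀ {n} {a b : Fin n} → a ≢ b → eqF a b ≡ false
eqF-false {a = a} {b} = ⌊⌋-false (a F.≟ b)

bool-ext : {x y : Bool} → (x ≡ true → y ≡ true) → (y ≡ true → x ≡ true) → x ≡ y
bool-ext {true} {true} f g = refl
bool-ext {true} {false} f g = sym (f refl)
bool-ext {false} {true} f g = g refl
bool-ext {false} {false} f g = refl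

∧-l : ∀ {a b} → a ∧ b ≡ true → a ≡ true
∧-l {true} e = refl

∧-r : ∀ {a b} → a ∧ b ≡ true → b ≡ true
∧-r {true} e = e

ltF-true : ∀ {m} {x y : Fin m} → toℕ x < toℕ y → ltF x y ≡ true
ltF-true p = Equivalence.to T-≡ (NP.<⇒<ᵇ p)

ltF-sound : ∀ {m} (x y : Fin m) → ltF x y ≡ true → toℕ x < toℕ y
ltF-sound x y e = NP.<ᵇ⇒< (toℕ x) (toℕ y) (Equivalence.from T-≡ e)

ltF-tri : ∀ {m} (x y : Fin m) → x ≢ y → ltF x y ≡ true ⊎ ltF y x ≡ true
ltF-tri x y x≢y with FP.<-cmp x y
... | tri< a _ _ = inj₁ (ltF-true a)
... | tri≈ _ b _ = ⊥-elim (x≢y b)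
... | tri> _ _ c = inj₂ (ltF-true c)

ltF-asym : ∀ {m} (x y : Fin m) → ltF x y ≡ true → ltF y x ≡ true → ⊥
ltF-asym x y a b = NP.<-asym (ltF-sound x y a) (ltF-sound y x b)

ltF-irr : ∀ {m} (x : Fin m) → ltF x x ≡ true → ⊥
ltF-irr x a = NP.<-irrefl refl (ltF-sound x x a)

module _ {A : Set} where

  vecs-∈ : (xs : List A) (m : ℕ) (v : Vec A m) → (∀ i → lookup v i ∈ xs) → v ∈ vecs xs m
  vecs-∈ xs zero []ᵥ h = here refl
  vecs-∈ xs (suc m) (a ∷ᵥ v) h =
    ∈-concatMap⁺ (λ v → map (_∷ᵥ v) xs) (lose (vecs-∈ xs m v (h ∘ F.suc)) (∈-map⁺ (_∷ᵥ v) (h F.zero)))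

  vecs-unique : (xs : List A) (m : ℕ) → Unique xs → Unique (vecs xs m)
  vecs-unique xs zero ux = [] ∷ []
  vecs-unique xs (suc m) ux = extend (vecs xs m) (vecs-unique xs m ux)
    where
      extend : (vs : List (Vec A m)) → Unique vs → Unique (concatMap (λ v → map (_∷ᵥ v) xs) vs)
      extend [] uv = []
      extend (v ∷ vs) (v∉ ∷ uv) =
        ++⁺ (map-unique⁺ VP.∷-injectiveˡ ux)
            (extend vs uv)
            (λ { (m₁ , m₂) → let (a , _ , e₁) = ∈-map⁻ (_∷ᵥ v) m₁
                                 (v' , mv' , m₃) = find (∈-concatMap⁻ (λ v → map (_∷ᵥ v) xs) m₂)
                                 (b , _ , e₂) = ∈-map⁻ (_∷ᵥ v') m₃
                             in All.lookup v∉ mv' (VP.∷-injectiveʳ (trans (sym e₁) e₂)) })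

InjVec : ∀ {A : Set} {m} → Vec A m → Set
InjVec {m = m} φ = ∀ (i j : Fin m) → lookup φ i ≡ lookup φ j → i ≡ j

impl-sound : ∀ {n} (b : Bool) (i j : Fin n) → (not b ∨ eqF i j) ≡ true → b ≡ true → i ≡ j
impl-sound true i j e refl = eqF-sound e

impl-intro : ∀ {n} (b : Bool) (i j : Fin n) → (b ≡ true → i ≡ j) → (not b ∨ eqF i j) ≡ true
impl-intro true i j h = subst (λ k → eqF i k ≡ true) (h refl) (eqF-refl i)
impl-intro false i j h = refl

injs-∈ : ∀ {m n} (φ : Vec (Fin n) m) → InjVec φ → φ ∈ injs m n
injs-∈ {m} {n} φ h = filterB-∈⁺ injB (vecs-∈ (allFin n) m φ (λ i → ∈-allFin _))
  (allL-intro _ (allFin m) (λ {i} _ → allL-intro _ (allFin m) (λ {j} _ →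
    impl-intro _ i j (λ e → h i j (eqF-sound e)))))

injs-inj : ∀ {m n} {φ : Vec (Fin n) m} → φ ∈ injs m n → InjVec φ
injs-inj {m} {n} {φ} mφ i j e = impl-sound _ i j
  (allL-true _ (allFin m) (allL-true _ (allFin m) injBφ (∈-allFin i)) (∈-allFin j))
  (subst (λ k → eqF (lookup φ i) k ≡ true) e (eqF-refl _))
  where injBφ : injB φ ≡ true
        injBφ = proj₂ (filterB-∈⁻ injB {xs = vecs (allFin n) m} mφ)

injs-unique : ∀ m n → Unique (injs m n)
injs-unique m n = filterB-unique injB (vecs-unique (allFin n) m (allFin⁺ n))

bothEq-just : ∀ {m} {x y : Maybe (Fin m)} {w : Fin m} → x ≡ just w → y ≡ just w → bothEq x y ≡ true
bothEq-just {w = w} refl refl = eqF-refl w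

bothEq-sound : ∀ {m} (x y : Maybe (Fin m)) → bothEq x y ≡ true → ∃ λ w → x ≡ just w × y ≡ just w
bothEq-sound (just a) (just b) e = a , refl , cong just (sym (eqF-sound e))

PInj : ∀ {m₁ m₂} → Vec (Maybe (Fin m₂)) m₁ → Set
PInj {m₁} {m₂} λ' = ∀ (i j : Fin m₁) (w : Fin m₂) → lookup λ' i ≡ just w → lookup λ' j ≡ just w → i ≡ j

optionalTargets : ∀ m → List (Maybe (Fin m))
optionalTargets m = nothing ∷ map just (allFin m)

pinjs-∈ : ∀ {m₁ m₂} (λ' : Vec (Maybe (Fin m₂)) m₁) → PInj λ' → λ' ∈ pinjs m₁ m₂
pinjs-∈ {m₁} {m₂} λ' h = filterB-∈⁺ pinjB (vecs-∈ (optionalTargets m₂) m₁ λ' (λ i → target∈ _))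
  (allL-intro _ (allFin m₁) (λ {i} _ → allL-intro _ (allFin m₁) (λ {j} _ →
    impl-intro _ i j (λ e → let (w , a , b) = bothEq-sound _ _ e in h i j w a b))))
  where
    target∈ : (x : Maybe (Fin m₂)) → x ∈ optionalTargets m₂
    target∈ nothing = here refl
    target∈ (just a) = there (∈-map⁺ just (∈-allFin a))

pinjs-pinj : ∀ {m₁ m₂} {λ' : Vec (Maybe (Fin m₂)) m₁} → λ' ∈ pinjs m₁ m₂ → PInj λ'
pinjs-pinj {m₁} {m₂} {λ'} mλ i j w ei ej = impl-sound _ i j
  (allL-true _ (allFin m₁) (allL-true _ (allFin m₁) pinjBλ (∈-allFin i)) (∈-allFin j)) (bothEq-just ei ej)
  where pinjBλ : pinjB λ' ≡ true
        pinjBλ = proj₂ (filterB-∈⁻ pinjB {xs = vecs (optionalTargets m₂) m₁} mλ)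

pinjs-unique : ∀ m₁ m₂ → Unique (pinjs m₁ m₂)
pinjs-unique m₁ m₂ = filterB-unique pinjB (vecs-unique (optionalTargets m₂) m₁ unique-targets)
  where
    unique-targets : Unique (optionalTargets m₂)
    unique-targets = All.tabulate (λ m → let (_ , _ , e) = ∈-map⁻ just m in λ e' → nothing≢just (trans e' e))
                     ∷ map-unique⁺ just-injective (allFin⁺ m₂)
      where nothing≢just : ∀ {a : Fin m₂} → nothing ≢ just a
            nothing≢just ()

module EdgeCount {m : ℕ} (A : Fin m → Fin m → Bool) (g : Fin m × Fin m → Bool) where

  edgeTerm : Fin m → Fin m → ℕ
  edgeTerm u v = ind ((ltF u v ∧ A u v) ∧ g (u , v))

  count-edges : countB g (edgesOf m A) ≡ ∑ (λ u → ∑ (edgeTerm u) (allFin m)) (allFin m)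
  count-edges = begin
      countB g (edgesOf m A)
        ≡⟨ countB-∑ g (edgesOf m A) ⟩
      ∑ (ind ∘ g) (edgesOf m A)
        ≡⟨ ∑-concatMap _ _ (allFin m) ⟩
      ∑ (λ u → ∑ (ind ∘ g) (concatMap (λ v → candidate u v) (allFin m))) (allFin m)
        ≡⟨ ∑-ext (allFin m) (λ u → ∑-concatMap _ _ (allFin m)) ⟩
      ∑ (λ u → ∑ (λ v → ∑ (ind ∘ g) (candidate u v)) (allFin m)) (allFin m)
        ≡⟨ ∑-ext (allFin m) (λ u → ∑-ext (allFin m) (λ v → single (ltF u v ∧ A u v) (u , v))) ⟩
      ∑ (λ u → ∑ (edgeTerm u) (allFin m)) (allFin m) ∎
    where
      open ≡-Reasoning
      candidate : Fin m → Fin m → List (Fin m × Fin m)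
      candidate u v = if ltF u v ∧ A u v then (u , v) ∷ [] else []
      single : (b : Bool) (e : Fin m × Fin m) → ∑ (ind ∘ g) (if b then e ∷ [] else []) ≡ ind (b ∧ g e)
      single true e = NP.+-identityʳ _
      single false e = refl

  count-edges-0 : (∀ e → g e ≡ false) → countB g (edgesOf m A) ≡ 0
  count-edges-0 h = trans (countB-∑ g (edgesOf m A)) (∑-zero _ (edgesOf m A) (λ {e} _ → cong ind (h e)))

  module _ (A-sym : ∀ u v → A u v ≡ A v u) (x y : Fin m) (x≢y : x ≢ y)
           (g-sound : ∀ u v → g (u , v) ≡ true → (u ≡ x × v ≡ y) ⊎ (u ≡ y × v ≡ x))
           (gxy : g (x , y) ≡ true) (gyx : g (y , x) ≡ true) where

    private
      ordered : (a b : Fin m) → ltF a b ≡ true → g (a , b) ≡ true →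
                (∀ u v → g (u , v) ≡ true → (u ≡ a × v ≡ b) ⊎ (u ≡ b × v ≡ a)) →
                ∑ (λ u → ∑ (edgeTerm u) (allFin m)) (allFin m) ≡ ind (A a b)
      ordered a b a<b gab gs =
        trans (∑-point _ (allFin m) a (allFin⁺ m) (∈-allFin a) rows-off)
              (trans (∑-point _ (allFin m) b (allFin⁺ m) (∈-allFin b) columns-off) at-ab)
        where
          rows-off : ∀ {u} → u ∈ allFin m → u ≢ a → ∑ (edgeTerm u) (allFin m) ≡ 0
          rows-off {u} _ u≢a = ∑-zero _ (allFin m) (λ {v} _ → cong ind (¬-not (λ t →
            excluded (gs u v (∧-r t)) (∧-l (∧-l t)))))
            where
              excluded : ∀ {v} → (u ≡ a × v ≡ b) ⊎ (u ≡ b × v ≡ a) → ltF u v ≡ true → ⊥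
              excluded (inj₁ (p , _)) _ = u≢a p
              excluded (inj₂ (refl , refl)) l = ltF-asym a b a<b l
          columns-off : ∀ {v} → v ∈ allFin m → v ≢ b → edgeTerm a v ≡ 0
          columns-off {v} _ v≢b = cong ind (¬-not (λ t → excluded (gs a v (∧-r t)) (∧-l (∧-l t))))
            where
              excluded : (a ≡ a × v ≡ b) ⊎ (a ≡ b × v ≡ a) → ltF a v ≡ true → ⊥
              excluded (inj₁ (_ , q)) _ = v≢b q
              excluded (inj₂ (_ , refl)) l = ltF-irr a l
          at-ab : edgeTerm a b ≡ ind (A a b)
          at-ab rewrite a<b | gab = cong ind (∧-identityʳ (A a b))

    count-edges-1 : countB g (edgesOf m A) ≡ ind (A x y)
    count-edges-1 with ltF-tri x y x≢y
    ... | inj₁ x<y = trans count-edges (ordered x y x<y gxy g-sound)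
    ... | inj₂ y<x = trans count-edges (trans (ordered y x y<x gyx
            (λ u v e → Data.Sum.swap (g-sound u v e))) (cong ind (A-sym y x)))

spG : ∀ {T : Set} → (T → T → Bool) → T → T → T → T → Bool
spG eq p q c d = (eq p c ∧ eq q d) ∨ (eq p d ∧ eq q c)

module PairMatch {T : Set} (eqT : T → T → Bool) (sound : ∀ {a b} → eqT a b ≡ true → a ≡ b)
                 (refl-eqT : ∀ a → eqT a a ≡ true) where

  spG-sound : ∀ p q c d → spG eqT p q c d ≡ true → (p ≡ c × q ≡ d) ⊎ (p ≡ d × q ≡ c)
  spG-sound p q c d e with eqT p c in e₁ | eqT q d in e₂
  ... | true | true = inj₁ (sound e₁ , sound e₂)
  ... | true | false = inj₂ (sound (∧-l e) , sound (∧-r e))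
  ... | false | _ = inj₂ (sound (∧-l e) , sound (∧-r e))

  spG-intro : ∀ p q c d → (p ≡ c × q ≡ d) ⊎ (p ≡ d × q ≡ c) → spG eqT p q c d ≡ true
  spG-intro p q .p .q (inj₁ (refl , refl)) rewrite refl-eqT p | refl-eqT q = refl
  spG-intro p q .q .p (inj₂ (refl , refl)) rewrite refl-eqT p | refl-eqT q = ∨-zeroʳ _

  at-most-one-edge : (dec : DecidableEquality T) {m : ℕ} (A : Fin m → Fin m → Bool)
    (A-sym : ∀ u v → A u v ≡ A v u) (κ : Fin m → T) (κ-inj : ∀ {u v} → κ u ≡ κ v → u ≡ v)
    (X Y : T) → X ≢ Y →
    countB (λ e → spG eqT (κ (proj₁ e)) (κ (proj₂ e)) X Y) (edgesOf m A) ≤ 1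
  at-most-one-edge dec {m} A A-sym κ κ-inj X Y X≢Y
    with FP.any? (λ u → dec (κ u) X) | FP.any? (λ u → dec (κ u) Y)
  ... | yes (x , κx) | yes (y , κy) =
    subst (_≤ 1) (sym (EdgeCount.count-edges-1 A g A-sym x y x≢y g-sound
                        (spG-intro _ _ _ _ (inj₁ (κx , κy))) (spG-intro _ _ _ _ (inj₂ (κy , κx)))))
          (ind≤1 _)
    where
      g : Fin m × Fin m → Bool
      g e = spG eqT (κ (proj₁ e)) (κ (proj₂ e)) X Y
      x≢y : x ≢ y
      x≢y e = X≢Y (trans (sym κx) (trans (cong κ e) κy))
      g-sound : ∀ u v → g (u , v) ≡ true → (u ≡ x × v ≡ y) ⊎ (u ≡ y × v ≡ x)
      g-sound u v t with spG-sound _ _ _ _ t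
      ... | inj₁ (a , b) = inj₁ (κ-inj (trans a (sym κx)) , κ-inj (trans b (sym κy)))
      ... | inj₂ (a , b) = inj₂ (κ-inj (trans a (sym κy)) , κ-inj (trans b (sym κx)))
  ... | no ¬X | _ = subst (_≤ 1) (sym (EdgeCount.count-edges-0 A _ (λ e → ¬-not (λ t →
                      missing (spG-sound _ _ _ _ t))))) z≤n
    where
      missing : ∀ {u v} → (κ u ≡ X × κ v ≡ Y) ⊎ (κ u ≡ Y × κ v ≡ X) → ⊥
      missing {u} (inj₁ (a , _)) = ¬X (u , a)
      missing {v = v} (inj₂ (_ , b)) = ¬X (v , b)
  ... | yes _ | no ¬Y = subst (_≤ 1) (sym (EdgeCount.count-edges-0 A _ (λ e → ¬-not (λ t →
                      missing (spG-sound _ _ _ _ t))))) z≤n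
    where
      missing : ∀ {u v} → (κ u ≡ X × κ v ≡ Y) ⊎ (κ u ≡ Y × κ v ≡ X) → ⊥
      missing {v = v} (inj₁ (_ , b)) = ¬Y (v , b)
      missing {u} (inj₂ (a , _)) = ¬Y (u , a)

module PairMatchFin {n : ℕ} = PairMatch (eqF {n}) eqF-sound eqF-refl

Mk : (n m : ℕ) → (Fin m → Fin m → Bool) → (Fin m → Bool) → Vec (Fin n) m → Mono n
Mk n m a L φ =
    prodM (map (λ e → xvar (lookup φ (proj₁ e)) (lookup φ (proj₂ e))) (edgesOf m a))
  · prodM (map (λ u → yvar (lookup φ u)) (filterB L (allFin m)))

EXk : (n m : ℕ) → (Fin m → Fin m → Bool) → Vec (Fin n) m → Fin n → Fin n → Bool
EXk n m a φ c d = xorAll (map (λ e → spG eqF c d (lookup φ (proj₁ e)) (lookup φ (proj₂ e))) (edgesOf m a))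

EYk : (n m : ℕ) → (Fin m → Bool) → Vec (Fin n) m → Fin n → Bool
EYk n m L φ c = xorAll (map (λ u → L u ∧ eqF c (lookup φ u)) (allFin m))

module _ {n : ℕ} where

  ex-prod : (ms : List (Mono n)) (c d : Fin n) → ex (prodM ms) c d ≡ xorAll (map (λ μ → ex μ c d) ms)
  ex-prod [] c d = refl
  ex-prod (μ ∷ ms) c d = cong (ex μ c d xor_) (ex-prod ms c d)

  ey-prod : (ms : List (Mono n)) (c : Fin n) → ey (prodM ms) c ≡ xorAll (map (λ μ → ey μ c) ms)
  ey-prod [] c = refl
  ey-prod (μ ∷ ms) c = cong (ey μ c xor_) (ey-prod ms c)

module _ (n m : ℕ) (a : Fin m → Fin m → Bool) (L : Fin m → Bool) (φ : Vec (Fin n) m) where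

  private
    xs-part ys-part : List (Mono n)
    xs-part = map (λ e → xvar (lookup φ (proj₁ e)) (lookup φ (proj₂ e))) (edgesOf m a)
    ys-part = map (λ u → yvar (lookup φ u)) (filterB L (allFin m))

  ex-Mk : ∀ c d → ex (Mk n m a L φ) c d ≡ EXk n m a φ c d
  ex-Mk c d = begin
      ex (prodM xs-part) c d xor ex (prodM ys-part) c d
        ≡⟨ cong₂ _xor_ (ex-prod xs-part c d) (ex-prod ys-part c d) ⟩
      xorAll (map (λ μ → ex μ c d) xs-part) xor xorAll (map (λ μ → ex μ c d) ys-part)
        ≡⟨ cong₂ _xor_ (cong xorAll (sym (map-∘ (edgesOf m a)))) (cong xorAll (sym (map-∘ (filterB L (allFin m))))) ⟩
      EXk n m a φ c d xor xorAll (map (λ u → false) (filterB L (allFin m)))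
        ≡⟨ cong (EXk n m a φ c d xor_) (xor-false (λ u → false) (filterB L (allFin m)) (λ _ → refl)) ⟩
      EXk n m a φ c d xor false
        ≡⟨ xor-identityʳ _ ⟩
      EXk n m a φ c d ∎
    where open ≡-Reasoning

  ey-Mk : ∀ c → ey (Mk n m a L φ) c ≡ EYk n m L φ c
  ey-Mk c = begin
      ey (prodM xs-part) c xor ey (prodM ys-part) c
        ≡⟨ cong₂ _xor_ (ey-prod xs-part c) (ey-prod ys-part c) ⟩
      xorAll (map (λ μ → ey μ c) xs-part) xor xorAll (map (λ μ → ey μ c) ys-part)
        ≡⟨ cong₂ _xor_ (cong xorAll (sym (map-∘ (edgesOf m a)))) (cong xorAll (sym (map-∘ (filterB L (allFin m))))) ⟩
      xorAll (map (λ e → false) (edgesOf m a)) xor xorAll (map (λ u → eqF c (lookup φ u)) (filterB L (allFin m)))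
        ≡⟨ cong₂ _xor_ (xor-false (λ e → false) (edgesOf m a) (λ _ → refl)) (xor-filterB _ L (allFin m)) ⟩
      EYk n m L φ c ∎
    where open ≡-Reasoning

==ᴹ-resp : ∀ {n} (μ₁ μ₂ μ : Mono n) → (∀ c d → ltF c d ≡ true → ex μ₁ c d ≡ ex μ₂ c d) →
           (∀ c → ey μ₁ c ≡ ey μ₂ c) → (μ₁ ==ᴹ μ) ≡ (μ₂ ==ᴹ μ)
==ᴹ-resp {n} μ₁ μ₂ μ hx hy = cong₂ _∧_
  (allL-cong (allFin n) (λ c → allL-cong (allFin n) (λ d → on-pair c d)))
  (allL-cong (allFin n) (λ c → cong (λ t → eqB t (ey μ c)) (hy c)))
  where
    on-pair : ∀ c d → (not (ltF c d) ∨ eqB (ex μ₁ c d) (ex μ c d)) ≡ (not (ltF c d) ∨ eqB (ex μ₂ c d) (ex μ c d))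
    on-pair c d with ltF c d in c<d
    ... | true = cong (λ t → eqB t (ex μ c d)) (hx c d c<d)
    ... | false = refl

module _ {n : ℕ} where

  coeff-map : ∀ {A : Set} (f : A → Mono n) (xs : List A) (μ : Mono n) →
              coeff (map f xs) μ ≡ ∑ (λ x → ind (f x ==ᴹ μ)) xs
  coeff-map f xs μ = trans (countB-∑ _ (map f xs)) (∑-map _ f xs)

  coeff-concatMap : ∀ {A : Set} (F : A → Poly n) (xs : List A) (μ : Mono n) →
                    coeff (concatMap F xs) μ ≡ ∑ (λ x → coeff (F x) μ) xs
  coeff-concatMap F xs μ = trans (countB-∑ _ (concatMap F xs))
    (trans (∑-concatMap _ F xs) (∑-ext xs (λ x → sym (countB-∑ _ (F x)))))

  coeff-⊗ : ∀ {A B : Set} (f : A → Mono n) (g : B → Mono n) (xs : List A) (ys : List B) (μ : Mono n) →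
            coeff (map f xs ⊗ map g ys) μ
              ≡ ∑ (λ p → ind ((f (proj₁ p) · g (proj₂ p)) ==ᴹ μ)) (cartesianProduct xs ys)
  coeff-⊗ f g xs ys μ = begin
      coeff (concatMap (λ a → map (a ·_) (map g ys)) (map f xs)) μ
        ≡⟨ coeff-concatMap _ (map f xs) μ ⟩
      ∑ (λ a → coeff (map (a ·_) (map g ys)) μ) (map f xs)
        ≡⟨ ∑-map _ f xs ⟩
      ∑ (λ x → coeff (map (f x ·_) (map g ys)) μ) xs
        ≡⟨ ∑-ext xs (λ x → trans (coeff-map _ (map g ys) μ) (∑-map _ g ys)) ⟩
      ∑ (λ x → ∑ (λ y → ind ((f x · g y) ==ᴹ μ)) ys) xs
        ≡⟨ sym (∑-cartesianProduct _ xs ys) ⟩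
      ∑ (λ p → ind ((f (proj₁ p) · g (proj₂ p)) ==ᴹ μ)) (cartesianProduct xs ys) ∎
    where open ≡-Reasoning

bothEq-just⁻ : ∀ {m} {x : Maybe (Fin m)} {w : Fin m} → bothEq x (just w) ≡ true → x ≡ just w
bothEq-just⁻ {x = x} {w} t = let (w' , a , b) = bothEq-sound x (just w) t in trans a (sym b)

module Product (J₁ J₂ : Graph) (L₁ : Fin (size J₁) → Bool) (L₂ : Fin (size J₂) → Bool) (n : ℕ) where

  Pair : Set
  Pair = Vec (Fin n) (size J₁) × Vec (Fin n) (size J₂)

  Pattern : Set
  Pattern = Vec (Maybe (Fin (size J₂))) (size J₁)

  _≟P_ : DecidableEquality Pattern
  _≟P_ = VP.≡-dec (MP.≡-dec FP._≟_)

  Pairs : List Pair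
  Pairs = cartesianProduct (injs (size J₁) n) (injs (size J₂) n)

  Patterns : List Pattern
  Patterns = pinjs (size J₁) (size J₂)

  pairMono : Pair → Mono n
  pairMono x = Mk n (size J₁) (adj J₁) L₁ (proj₁ x) · Mk n (size J₂) (adj J₂) L₂ (proj₂ x)

  overlapOf : Pair → Pattern
  overlapOf (φ₁ , φ₂) = tabulate (λ v → findB (size J₂) (λ w → eqF (lookup φ₂ w) (lookup φ₁ v)))

  withPattern : Pattern → List Pair
  withPattern λ' = filterB (λ x → ⌊ overlapOf x ≟P λ' ⌋) Pairs

  overlapOf-just : (x : Pair) (v : Fin (size J₁)) (w : Fin (size J₂)) → lookup (overlapOf x) v ≡ just w →
                 lookup (proj₂ x) w ≡ lookup (proj₁ x) v
  overlapOf-just (φ₁ , φ₂) v w e =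
    eqF-sound (findL-just _ (allFin (size J₂)) (trans (sym (lookup∘tabulate _ v)) e))

  overlapOf-find : (x : Pair) → proj₂ x ∈ injs (size J₂) n → (v : Fin (size J₁)) (w : Fin (size J₂)) →
                 lookup (proj₂ x) w ≡ lookup (proj₁ x) v → lookup (overlapOf x) v ≡ just w
  overlapOf-find (φ₁ , φ₂) φ₂-inj v w e = trans (lookup∘tabulate _ v)
    (findL-unique _ (allFin (size J₂)) w (∈-allFin w)
      (subst (λ t → eqF (lookup φ₂ w) t ≡ true) e (eqF-refl _))
      (λ {w'} _ t → injs-inj φ₂-inj w' w (trans (eqF-sound t) (sym e))))

  overlapOf-∈ : (x : Pair) → x ∈ Pairs → overlapOf x ∈ Patterns
  overlapOf-∈ x mx = pinjs-∈ (overlapOf x) (λ i j w ei ej →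
    injs-inj (proj₁ (∈-cartesianProduct⁻ _ _ mx)) i j
      (trans (sym (overlapOf-just x i w ei)) (overlapOf-just x j w ej)))

  module Glue (λ' : Pattern) (λ'-pinj : PInj λ') where
    open Merge J₁ J₂ L₁ L₂ λ'

    private
      inj₂≢inj₁ : ∀ {a : Fin m₁} {b : Fin m₂} → (V ∋ inj₂ b) ≢ inj₁ a
      inj₂≢inj₁ ()
      false≢true : false ≢ true
      false≢true ()

    Unmatched : Fin m₂ → Set
    Unmatched w = ∀ v → lookup λ' v ≢ just w

    data ι₂-View (w : Fin m₂) : Set where
      matched : (v : Fin m₁) → lookup λ' v ≡ just w → ι₂ w ≡ inj₁ v → ι₂-View w
      unmatched : Unmatched w → ι₂ w ≡ inj₂ w → ι₂-View w

    ι₂-view : ∀ w → ι₂-View w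
    ι₂-view w with findB m₁ (λ v → bothEq (lookup λ' v) (just w)) in e
    ... | just v = matched v (bothEq-just⁻ (findL-just _ (allFin m₁) e)) ι₂-found
      where
        ι₂-found : ι₂ w ≡ inj₁ v
        ι₂-found rewrite e = refl
    ... | nothing = unmatched (λ v ev → false≢true (trans (sym (findL-nothing _ (allFin m₁) e (∈-allFin v)))
                                                         (bothEq-just ev refl))) ι₂-missed
      where
        ι₂-missed : ι₂ w ≡ inj₂ w
        ι₂-missed rewrite e = refl

    λ'→ι₂ : ∀ {v w} → lookup λ' v ≡ just w → ι₂ w ≡ inj₁ v
    λ'→ι₂ {v} {w} e with ι₂-view w
    ... | matched v' e' ι = subst (λ t → ι₂ w ≡ inj₁ t) (λ'-pinj v' v w e' e) ι
    ... | unmatched nw _ = ⊥-elim (nw v e)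

    ι₂→λ' : ∀ {v w} → ι₂ w ≡ inj₁ v → lookup λ' v ≡ just w
    ι₂→λ' {v} {w} h with ι₂-view w
    ... | matched v' e' ι = subst (λ t → lookup λ' t ≡ just w) (SP.inj₁-injective (trans (sym ι) h)) e'
    ... | unmatched _ ι = ⊥-elim (inj₂≢inj₁ (trans (sym ι) h))

    unmatched→ι₂ : ∀ {w} → Unmatched w → ι₂ w ≡ inj₂ w
    unmatched→ι₂ {w} nw with ι₂-view w
    ... | matched v e _ = ⊥-elim (nw v e)
    ... | unmatched _ ι = ι

    -- λ' being injective, the identification map on V(J₂) is injective
    ι₂-inj : ∀ {w w'} → ι₂ w ≡ ι₂ w' → w ≡ w'
    ι₂-inj {w} {w'} h with ι₂-view w | ι₂-view w'
    ... | matched v e ι | matched v' e' ι' =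
      just-injective (trans (sym e) (subst (λ t → lookup λ' t ≡ just w')
                                           (sym (SP.inj₁-injective (trans (sym ι) (trans h ι')))) e'))
    ... | matched v e ι | unmatched _ ι' = ⊥-elim (inj₂≢inj₁ (trans (sym ι') (trans (sym h) ι)))
    ... | unmatched _ ι | matched v' e' ι' = ⊥-elim (inj₂≢inj₁ (trans (sym ι) (trans h ι')))
    ... | unmatched _ ι | unmatched _ ι' = SP.inj₂-injective (trans (sym ι) (trans h ι'))

    eqV-sound : ∀ {a b} → eqV a b ≡ true → a ≡ b
    eqV-sound {inj₁ a} {inj₁ b} e = cong inj₁ (eqF-sound e)
    eqV-sound {inj₂ a} {inj₂ b} e = cong inj₂ (eqF-sound e)

    eqV-refl : ∀ a → eqV a a ≡ true
    eqV-refl (inj₁ a) = eqF-refl a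
    eqV-refl (inj₂ a) = eqF-refl a

    _≟V_ : DecidableEquality V
    _≟V_ = SP.≡-dec FP._≟_ FP._≟_

    vlist-unique : Unique vlist
    vlist-unique = ++⁺ (map-unique⁺ SP.inj₁-injective (allFin⁺ m₁))
                       (map-unique⁺ SP.inj₂-injective (filterB-unique _ (allFin⁺ m₂)))
                       (λ { (a , b) → let (_ , _ , e₁) = ∈-map⁻ inj₁ a ; (_ , _ , e₂) = ∈-map⁻ inj₂ b
                                      in inj₂≢inj₁ (trans (sym e₂) e₁) })

    ι₁∈ : ∀ u → ι₁ u ∈ vlist
    ι₁∈ u = ∈-++⁺ˡ (∈-map⁺ inj₁ (∈-allFin u))

    ι₂∈ : ∀ w → ι₂ w ∈ vlist
    ι₂∈ w with ι₂-view w
    ... | matched v _ ι = subst (_∈ vlist) (sym ι) (ι₁∈ v)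
    ... | unmatched nw ι = subst (_∈ vlist) (sym ι)
            (∈-++⁺ʳ (map inj₁ (allFin m₁)) (∈-map⁺ inj₂ (filterB-∈⁺ _ (∈-allFin w) (cong not not-image))))
      where
        not-image : isImg w ≡ false
        not-image = anyL-intro-false _ (allFin m₁) (λ {v} _ → ¬-not (λ t → nw v (bothEq-just⁻ t)))

    vlist-inj₂ : ∀ {w} → inj₂ w ∈ vlist → Unmatched w
    vlist-inj₂ {w} m with ∈-++⁻ (map inj₁ (allFin m₁)) m
    ... | inj₁ a = let (_ , _ , e) = ∈-map⁻ inj₁ a in ⊥-elim (inj₂≢inj₁ e)
    ... | inj₂ b = let (w' , mw' , e) = ∈-map⁻ inj₂ b
                       kept = proj₂ (filterB-∈⁻ (λ w → not (isImg w)) {xs = allFin m₂} mw')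
                       not-image = trans (sym (not-involutive _)) (cong not kept)
                   in subst Unmatched (sym (SP.inj₂-injective e))
                        (λ v e' → false≢true (trans (sym (anyL-false _ (allFin m₁) not-image (∈-allFin v)))
                                                    (bothEq-just e' refl)))

    lab-inj : ∀ {a b} → lab a ≡ lab b → a ≡ b
    lab-inj = lookup-inj vlist vlist-unique

    index-lab : ∀ {x} (p : x ∈ vlist) {a} → x ≡ lab a → index p ≡ a
    index-lab p e = lab-inj (trans (sym (lookup-index p)) e)

    lab-unmatched : ∀ {a w} → lab a ≡ inj₂ w → Unmatched w
    lab-unmatched {a} e = vlist-inj₂ (subst (_∈ vlist) e (∈-lookup a))

    split : Vec (Fin n) size' → Pair
    split ψ = tabulate (λ u → lookup ψ (index (ι₁∈ u))) , tabulate (λ w → lookup ψ (index (ι₂∈ w)))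

    select : Pair → V → Fin n
    select (φ₁ , φ₂) (inj₁ u) = lookup φ₁ u
    select (φ₁ , φ₂) (inj₂ w) = lookup φ₂ w

    glue : Pair → Vec (Fin n) size'
    glue x = tabulate (λ a → select x (lab a))

    Injections : List (Vec (Fin n) size')
    Injections = injs size' n

    module Split {ψ : Vec (Fin n) size'} (ψ∈ : ψ ∈ Injections) where
      ψ-inj : InjVec ψ
      ψ-inj = injs-inj ψ∈

      ψ-vertex-inj : ∀ {x y} (p : x ∈ vlist) (q : y ∈ vlist) → lookup ψ (index p) ≡ lookup ψ (index q) → x ≡ y
      ψ-vertex-inj p q e = trans (lookup-index p) (trans (cong lab (ψ-inj _ _ e)) (sym (lookup-index q)))

      ψ-vertex-cong : ∀ {x y} (p : x ∈ vlist) (q : y ∈ vlist) → x ≡ y → lookup ψ (index p) ≡ lookup ψ (index q)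
      ψ-vertex-cong p q e = cong (lookup ψ) (lab-inj (trans (sym (lookup-index p)) (trans e (lookup-index q))))

      φ₁ : Vec (Fin n) m₁
      φ₁ = proj₁ (split ψ)
      φ₂ : Vec (Fin n) m₂
      φ₂ = proj₂ (split ψ)

      φ₁≡ : ∀ u → lookup φ₁ u ≡ lookup ψ (index (ι₁∈ u))
      φ₁≡ u = lookup∘tabulate _ u

      φ₂≡ : ∀ w → lookup φ₂ w ≡ lookup ψ (index (ι₂∈ w))
      φ₂≡ w = lookup∘tabulate _ w

      φ₁-inj : InjVec φ₁
      φ₁-inj i j e = SP.inj₁-injective (ψ-vertex-inj (ι₁∈ i) (ι₁∈ j) (trans (sym (φ₁≡ i)) (trans e (φ₁≡ j))))

      φ₂-inj : InjVec φ₂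
      φ₂-inj i j e = ι₂-inj (ψ-vertex-inj (ι₂∈ i) (ι₂∈ j) (trans (sym (φ₂≡ i)) (trans e (φ₂≡ j))))

      coincidence→λ' : ∀ {v w} → lookup φ₂ w ≡ lookup φ₁ v → lookup λ' v ≡ just w
      coincidence→λ' {v} {w} e = ι₂→λ' (ψ-vertex-inj (ι₂∈ w) (ι₁∈ v) (trans (sym (φ₂≡ w)) (trans e (φ₁≡ v))))

      overlap-split : overlapOf (split ψ) ≡ λ'
      overlap-split = trans (tabulate-cong at) (tabulate∘lookup λ')
        where
          at : ∀ v → findB m₂ (λ w → eqF (lookup φ₂ w) (lookup φ₁ v)) ≡ lookup λ' v
          at v with lookup λ' v in e
          ... | just w₀ = findL-unique _ (allFin m₂) w₀ (∈-allFin w₀)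
                  (subst (λ t → eqF (lookup φ₂ w₀) t ≡ true)
                     (trans (φ₂≡ w₀) (trans (ψ-vertex-cong (ι₂∈ w₀) (ι₁∈ v) (λ'→ι₂ e)) (sym (φ₁≡ v))))
                     (eqF-refl _))
                  (λ {w} _ t → just-injective (trans (sym (coincidence→λ' (eqF-sound t))) e))
          ... | nothing = findL-none _ (allFin m₂) (λ {w} _ → ¬-not (λ t →
                  nothing≢just (trans (sym e) (coincidence→λ' (eqF-sound t)))))
            where nothing≢just : ∀ {w} → (Maybe (Fin m₂) ∋ nothing) ≢ just w
                  nothing≢just ()

      split∈ : split ψ ∈ withPattern λ'
      split∈ = filterB-∈⁺ _ (∈-cartesianProduct⁺ (injs-∈ φ₁ φ₁-inj) (injs-∈ φ₂ φ₂-inj))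
                          (⌊⌋-true (overlapOf (split ψ) ≟P λ') overlap-split)

      glue-split : glue (split ψ) ≡ ψ
      glue-split = trans (tabulate-cong at) (tabulate∘lookup ψ)
        where
          at : ∀ a → select (φ₁ , φ₂) (lab a) ≡ lookup ψ a
          at a with lab a in e
          ... | inj₁ u = trans (φ₁≡ u) (cong (lookup ψ) (index-lab (ι₁∈ u) (sym e)))
          ... | inj₂ w = trans (φ₂≡ w) (cong (lookup ψ) (index-lab (ι₂∈ w)
                           (trans (unmatched→ι₂ (lab-unmatched e)) (sym e))))

    module Glued {φ₁ : Vec (Fin n) (size J₁)} {φ₂ : Vec (Fin n) (size J₂)} (x∈ : (φ₁ , φ₂) ∈ withPattern λ') where
      private
        x : Pair
        x = (φ₁ , φ₂)
        filtered : x ∈ Pairs × ⌊ overlapOf x ≟P λ' ⌋ ≡ true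
        filtered = filterB-∈⁻ (λ x → ⌊ overlapOf x ≟P λ' ⌋) {xs = Pairs} x∈
        injective : φ₁ ∈ injs m₁ n × φ₂ ∈ injs m₂ n
        injective = ∈-cartesianProduct⁻ (injs m₁ n) (injs m₂ n) (proj₁ filtered)

      overlap-x : overlapOf x ≡ λ'
      overlap-x with overlapOf x ≟P λ' | proj₂ filtered
      ... | yes p | _ = p

      glue≡ : ∀ a → lookup (glue x) a ≡ select x (lab a)
      glue≡ a = lookup∘tabulate _ a

      unmatched-apart : ∀ u w → lookup φ₁ u ≡ lookup φ₂ w → Unmatched w → ⊥
      unmatched-apart u w e nw =
        nw u (trans (sym (cong (λ t → lookup t u) overlap-x)) (overlapOf-find x (proj₂ injective) u w (sym e)))

      select-inj : ∀ a b X Y → lab a ≡ X → lab b ≡ Y → select x X ≡ select x Y → a ≡ b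
      select-inj a b (inj₁ u) (inj₁ u') ea eb e =
        lab-inj (trans ea (trans (cong inj₁ (injs-inj (proj₁ injective) u u' e)) (sym eb)))
      select-inj a b (inj₂ w) (inj₂ w') ea eb e =
        lab-inj (trans ea (trans (cong inj₂ (injs-inj (proj₂ injective) w w' e)) (sym eb)))
      select-inj a b (inj₁ u) (inj₂ w) ea eb e = ⊥-elim (unmatched-apart u w e (lab-unmatched eb))
      select-inj a b (inj₂ w) (inj₁ u) ea eb e = ⊥-elim (unmatched-apart u w (sym e) (lab-unmatched ea))

      glue∈ : glue x ∈ Injections
      glue∈ = injs-∈ (glue x) (λ a b e → select-inj a b (lab a) (lab b) refl refl
                                           (trans (sym (glue≡ a)) (trans e (glue≡ b))))

      split-glue : split (glue x) ≡ x
      split-glue = cong₂ _,_ (trans (tabulate-cong on₁) (tabulate∘lookup φ₁))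
                             (trans (tabulate-cong on₂) (tabulate∘lookup φ₂))
        where
          on₁ : ∀ u → lookup (glue x) (index (ι₁∈ u)) ≡ lookup φ₁ u
          on₁ u = trans (glue≡ _) (cong (select x) (sym (lookup-index (ι₁∈ u))))
          on₂ : ∀ w → lookup (glue x) (index (ι₂∈ w)) ≡ lookup φ₂ w
          on₂ w = trans (glue≡ _) (trans (cong (select x) (sym (lookup-index (ι₂∈ w)))) (by-view (ι₂-view w)))
            where
              by-view : ι₂-View w → select x (ι₂ w) ≡ lookup φ₂ w
              by-view (matched v e ι) rewrite ι =
                sym (overlapOf-just x v w (trans (cong (λ t → lookup t v) overlap-x) e))
              by-view (unmatched _ ι) rewrite ι = refl

    ∑-withPattern : ∀ (h : Pair → ℕ) → ∑ h (withPattern λ') ≡ ∑ (h ∘ split) Injections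
    ∑-withPattern h = ∑-bijection (withPattern λ') Injections split glue
      (filterB-unique _ (cartesianProduct⁺ (injs-unique _ n) (injs-unique _ n)))
      (injs-unique size' n)
      Split.split∈ Split.glue-split
      (λ { {φ₁ , φ₂} m → Glued.glue∈ m }) (λ { {φ₁ , φ₂} m → Glued.split-glue m }) h

    adj'-sym : ∀ a b → adj' a b ≡ adj' b a
    adj'-sym a b = cong (_≡ᵇ 1) (cong₂ _+_ (countB-ext (edgesOf m₁ (adj J₁)) (swap-pair ι₁))
                                           (countB-ext (edgesOf m₂ (adj J₂)) (swap-pair ι₂)))
      where
        swap-pair : ∀ {k} (ι : Fin k → V) (e : Fin k × Fin k) →
                    samePair (ι (proj₁ e)) (ι (proj₂ e)) (lab a) (lab b) ≡ samePair (ι (proj₁ e)) (ι (proj₂ e)) (lab b) (lab a)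
        swap-pair ι e = ∨-comm (eqV (ι (proj₁ e)) (lab a) ∧ eqV (ι (proj₂ e)) (lab b))
                               (eqV (ι (proj₁ e)) (lab b) ∧ eqV (ι (proj₂ e)) (lab a))

    module PairMatchV = PairMatch eqV eqV-sound eqV-refl

    module Monomial {ψ : Vec (Fin n) size'} (ψ∈ : ψ ∈ Injections) where
      open Split ψ∈

      eqF-ψ : ∀ a₀ {x} (p : x ∈ vlist) → eqF (lookup ψ a₀) (lookup ψ (index p)) ≡ eqV x (lab a₀)
      eqF-ψ a₀ {x} p = bool-ext
        (λ t → subst (λ z → eqV x z ≡ true)
                 (trans (lookup-index p) (cong lab (sym (ψ-inj _ _ (eqF-sound t))))) (eqV-refl x))
        (λ t → subst (λ z → eqF (lookup ψ a₀) (lookup ψ z) ≡ true)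
                 (sym (index-lab p (eqV-sound t))) (eqF-refl _))

      spG-ψ : ∀ a₀ b₀ {x y} (p : x ∈ vlist) (q : y ∈ vlist) →
              spG eqF (lookup ψ a₀) (lookup ψ b₀) (lookup ψ (index p)) (lookup ψ (index q))
                ≡ samePair x y (lab a₀) (lab b₀)
      spG-ψ a₀ b₀ {x} {y} p q =
        cong₂ _∨_ (cong₂ _∧_ (eqF-ψ a₀ p) (eqF-ψ b₀ q))
                  (trans (cong₂ _∧_ (eqF-ψ a₀ q) (eqF-ψ b₀ p)) (∧-comm (eqV y (lab a₀)) (eqV x (lab b₀))))

      OffImage : Fin n → Set
      OffImage c = ∀ a → lookup ψ a ≢ c

      spG-off : ∀ {c d} → OffImage c ⊎ OffImage d → ∀ i j → spG eqF c d (lookup ψ i) (lookup ψ j) ≡ false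
      spG-off {c} {d} off i j = ¬-not (λ t → excluded off (PairMatchFin.spG-sound c d (lookup ψ i) (lookup ψ j) t))
        where
          excluded : OffImage c ⊎ OffImage d →
                     (c ≡ lookup ψ i × d ≡ lookup ψ j) ⊎ (c ≡ lookup ψ j × d ≡ lookup ψ i) → ⊥
          excluded (inj₁ c∉) (inj₁ (e , _)) = c∉ i (sym e)
          excluded (inj₁ c∉) (inj₂ (e , _)) = c∉ j (sym e)
          excluded (inj₂ d∉) (inj₁ (_ , e)) = d∉ j (sym e)
          excluded (inj₂ d∉) (inj₂ (_ , e)) = d∉ i (sym e)

      E₁ : List (Fin m₁ × Fin m₁)
      E₁ = edgesOf m₁ (adj J₁)
      E₂ : List (Fin m₂ × Fin m₂)
      E₂ = edgesOf m₂ (adj J₂)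
      E' : List (Fin size' × Fin size')
      E' = edgesOf size' adj'

      spG-φ₁ : ∀ c d u v → spG eqF c d (lookup φ₁ u) (lookup φ₁ v)
                           ≡ spG eqF c d (lookup ψ (index (ι₁∈ u))) (lookup ψ (index (ι₁∈ v)))
      spG-φ₁ c d u v = cong₂ (spG eqF c d) (φ₁≡ u) (φ₁≡ v)

      spG-φ₂ : ∀ c d u v → spG eqF c d (lookup φ₂ u) (lookup φ₂ v)
                           ≡ spG eqF c d (lookup ψ (index (ι₂∈ u))) (lookup ψ (index (ι₂∈ v)))
      spG-φ₂ c d u v = cong₂ (spG eqF c d) (φ₂≡ u) (φ₂≡ v)

      EX-off : ∀ {c d} → OffImage c ⊎ OffImage d →
               EXk n m₁ (adj J₁) φ₁ c d xor EXk n m₂ (adj J₂) φ₂ c d ≡ EXk n size' adj' ψ c d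
      EX-off {c} {d} off = trans
        (cong₂ _xor_ (xor-false _ E₁ (λ {e} _ → trans (spG-φ₁ c d (proj₁ e) (proj₂ e)) (spG-off off _ _)))
                     (xor-false _ E₂ (λ {e} _ → trans (spG-φ₂ c d (proj₁ e) (proj₂ e)) (spG-off off _ _))))
        (sym (xor-false _ E' (λ {e} _ → spG-off off (proj₁ e) (proj₂ e))))

      onto : Fin size' → Fin size' → Fin size' × Fin size' → Bool
      onto a₀ b₀ e = spG eqF (lookup ψ a₀) (lookup ψ b₀) (lookup ψ (proj₁ e)) (lookup ψ (proj₂ e))

      -- ψ being injective, only the edge a₀b₀ itself (if present) is sent onto that pair
      glued-edge-count : ∀ a₀ b₀ → a₀ ≢ b₀ → countB (onto a₀ b₀) E' ≡ ind (adj' a₀ b₀)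
      glued-edge-count a₀ b₀ a₀≢b₀ =
        EdgeCount.count-edges-1 adj' (onto a₀ b₀) adj'-sym a₀ b₀ a₀≢b₀ onto-sound
          (PairMatchFin.spG-intro c d c d (inj₁ (refl , refl)))
          (PairMatchFin.spG-intro c d d c (inj₂ (refl , refl)))
        where
          onto-sound : ∀ u v → onto a₀ b₀ (u , v) ≡ true → (u ≡ a₀ × v ≡ b₀) ⊎ (u ≡ b₀ × v ≡ a₀)
          onto-sound u v t with PairMatchFin.spG-sound _ _ _ _ t
          ... | inj₁ (p , q) = inj₁ (ψ-inj _ _ (sym p) , ψ-inj _ _ (sym q))
          ... | inj₂ (p , q) = inj₂ (ψ-inj _ _ (sym q) , ψ-inj _ _ (sym p))
          c d : Fin n
          c = lookup ψ a₀
          d = lookup ψ b₀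

      EX-on : ∀ a₀ b₀ → ltF (lookup ψ a₀) (lookup ψ b₀) ≡ true →
              EXk n m₁ (adj J₁) φ₁ (lookup ψ a₀) (lookup ψ b₀) xor EXk n m₂ (adj J₂) φ₂ (lookup ψ a₀) (lookup ψ b₀)
                ≡ EXk n size' adj' ψ (lookup ψ a₀) (lookup ψ b₀)
      EX-on a₀ b₀ lt = begin
          EXk n m₁ (adj J₁) φ₁ c d xor EXk n m₂ (adj J₂) φ₂ c d
            ≡⟨ cong₂ _xor_ (xor-parity _ E₁) (xor-parity _ E₂) ⟩
          par (countB (λ e → spG eqF c d (lookup φ₁ (proj₁ e)) (lookup φ₁ (proj₂ e))) E₁)
            xor par (countB (λ e → spG eqF c d (lookup φ₂ (proj₁ e)) (lookup φ₂ (proj₂ e))) E₂)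
            ≡⟨ cong₂ _xor_ (cong par (countB-ext E₁ (λ e → trans (spG-φ₁ c d (proj₁ e) (proj₂ e))
                                                                  (spG-ψ a₀ b₀ (ι₁∈ (proj₁ e)) (ι₁∈ (proj₂ e))))))
                           (cong par (countB-ext E₂ (λ e → trans (spG-φ₂ c d (proj₁ e) (proj₂ e))
                                                                  (spG-ψ a₀ b₀ (ι₂∈ (proj₁ e)) (ι₂∈ (proj₂ e)))))) ⟩
          par n₁ xor par n₂
            ≡⟨ par-sum n₁ n₂ n₁≤1 n₂≤1 ⟩
          adj' a₀ b₀
            ≡⟨ sym (par-ind _) ⟩
          par (ind (adj' a₀ b₀))
            ≡⟨ cong par (sym (glued-edge-count a₀ b₀ a₀≢b₀)) ⟩
          par (countB (onto a₀ b₀) E')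
            ≡⟨ sym (xor-parity _ E') ⟩
          EXk n size' adj' ψ c d ∎
        where
          open ≡-Reasoning
          c d : Fin n
          c = lookup ψ a₀
          d = lookup ψ b₀
          X Y : V
          X = lab a₀
          Y = lab b₀
          n₁ n₂ : ℕ
          n₁ = countB (λ e → samePair (ι₁ (proj₁ e)) (ι₁ (proj₂ e)) X Y) E₁
          n₂ = countB (λ e → samePair (ι₂ (proj₁ e)) (ι₂ (proj₂ e)) X Y) E₂
          a₀≢b₀ : a₀ ≢ b₀
          a₀≢b₀ e = ltF-irr c (subst (λ z → ltF c (lookup ψ z) ≡ true) (sym e) lt)
          n₁≤1 : n₁ ≤ 1
          n₁≤1 = PairMatchV.at-most-one-edge _≟V_ (adj J₁) (adj-sym J₁) ι₁ SP.inj₁-injective X Y (a₀≢b₀ ∘ lab-inj)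
          n₂≤1 : n₂ ≤ 1
          n₂≤1 = PairMatchV.at-most-one-edge _≟V_ (adj J₂) (adj-sym J₂) ι₂ ι₂-inj X Y (a₀≢b₀ ∘ lab-inj)

      EX-glue : ∀ c d → ltF c d ≡ true →
                EXk n m₁ (adj J₁) φ₁ c d xor EXk n m₂ (adj J₂) φ₂ c d ≡ EXk n size' adj' ψ c d
      EX-glue c d lt with FP.any? (λ a → lookup ψ a FP.≟ c) | FP.any? (λ a → lookup ψ a FP.≟ d)
      ... | yes (a₀ , refl) | yes (b₀ , refl) = EX-on a₀ b₀ lt
      ... | no c∉ | _ = EX-off {c} {d} (inj₁ (λ a e → c∉ (a , e)))
      ... | yes _ | no d∉ = EX-off {c} {d} (inj₂ (λ a e → d∉ (a , e)))

      -- blue vertices of J₁ and J₂ sent to ψ(a₀) are those identified with lab a₀,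
      -- so the y-exponent there is the XOR colour L' a₀
      EY-on : ∀ a₀ → EYk n m₁ L₁ φ₁ (lookup ψ a₀) xor EYk n m₂ L₂ φ₂ (lookup ψ a₀) ≡ EYk n size' L' ψ (lookup ψ a₀)
      EY-on a₀ = begin
          EYk n m₁ L₁ φ₁ c xor EYk n m₂ L₂ φ₂ c
            ≡⟨ cong₂ _xor_ (xor-cong (allFin m₁) (λ {u} _ → trans (∧-comm (L₁ u) _)
                                (cong (_∧ L₁ u) (trans (cong (eqF c) (φ₁≡ u)) (eqF-ψ a₀ (ι₁∈ u))))))
                           (xor-cong (allFin m₂) (λ {w} _ → trans (∧-comm (L₂ w) _)
                                (cong (_∧ L₂ w) (trans (cong (eqF c) (φ₂≡ w)) (eqF-ψ a₀ (ι₂∈ w)))))) ⟩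
          xorAll (map (λ u → eqV (ι₁ u) (lab a₀) ∧ L₁ u) (allFin m₁))
            xor xorAll (map (λ w → eqV (ι₂ w) (lab a₀) ∧ L₂ w) (allFin m₂))
            ≡⟨ sym (cong₂ _xor_ (xor-filterB L₁ (λ u → eqV (ι₁ u) (lab a₀)) (allFin m₁))
                                (xor-filterB L₂ (λ w → eqV (ι₂ w) (lab a₀)) (allFin m₂))) ⟩
          xorAll (map L₁ (filterB (λ u → eqV (ι₁ u) (lab a₀)) (allFin m₁)))
            xor xorAll (map L₂ (filterB (λ w → eqV (ι₂ w) (lab a₀)) (allFin m₂)))
            ≡⟨ sym (xor-++ (map L₁ (filterB (λ u → eqV (ι₁ u) (lab a₀)) (allFin m₁)))
                           (map L₂ (filterB (λ w → eqV (ι₂ w) (lab a₀)) (allFin m₂)))) ⟩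
          L' a₀
            ≡⟨ sym (∧-identityʳ (L' a₀)) ⟩
          L' a₀ ∧ true
            ≡⟨ cong (L' a₀ ∧_) (sym (eqF-refl c)) ⟩
          L' a₀ ∧ eqF c (lookup ψ a₀)
            ≡⟨ sym (xor-point (λ a → L' a ∧ eqF c (lookup ψ a)) (allFin size') a₀ (allFin⁺ size') (∈-allFin a₀)
                 (λ {a} _ a≢a₀ → trans (cong (L' a ∧_) (eqF-false (λ e → a≢a₀ (ψ-inj _ _ (sym e))))) (∧-zeroʳ (L' a)))) ⟩
          EYk n size' L' ψ c ∎
        where
          open ≡-Reasoning
          c : Fin n
          c = lookup ψ a₀

      EY-off : ∀ {c} → OffImage c → EYk n m₁ L₁ φ₁ c xor EYk n m₂ L₂ φ₂ c ≡ EYk n size' L' ψ c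
      EY-off {c} c∉ = trans
        (cong₂ _xor_ (xor-false _ (allFin m₁) (λ {u} _ → trans (cong (L₁ u ∧_) (trans (cong (eqF c) (φ₁≡ u)) (miss _))) (∧-zeroʳ (L₁ u))))
                     (xor-false _ (allFin m₂) (λ {w} _ → trans (cong (L₂ w ∧_) (trans (cong (eqF c) (φ₂≡ w)) (miss _))) (∧-zeroʳ (L₂ w)))))
        (sym (xor-false _ (allFin size') (λ {a} _ → trans (cong (L' a ∧_) (miss a)) (∧-zeroʳ (L' a)))))
        where
          miss : ∀ a → eqF c (lookup ψ a) ≡ false
          miss a = eqF-false (λ e → c∉ a (sym e))

      EY-glue : ∀ c → EYk n m₁ L₁ φ₁ c xor EYk n m₂ L₂ φ₂ c ≡ EYk n size' L' ψ c
      EY-glue c with FP.any? (λ a → lookup ψ a FP.≟ c)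
      ... | yes (a₀ , refl) = EY-on a₀
      ... | no c∉ = EY-off (λ a e → c∉ (a , e))

      pairMono-split : ∀ μ → (pairMono (split ψ) ==ᴹ μ) ≡ (Mk n size' adj' L' ψ ==ᴹ μ)
      pairMono-split μ = ==ᴹ-resp _ _ μ
        (λ c d lt → trans (cong₂ _xor_ (ex-Mk n m₁ (adj J₁) L₁ φ₁ c d) (ex-Mk n m₂ (adj J₂) L₂ φ₂ c d))
                          (trans (EX-glue c d lt) (sym (ex-Mk n size' adj' L' ψ c d))))
        (λ c → trans (cong₂ _xor_ (ey-Mk n m₁ (adj J₁) L₁ φ₁ c) (ey-Mk n m₂ (adj J₂) L₂ φ₂ c))
                     (trans (EY-glue c) (sym (ey-Mk n size' adj' L' ψ c))))

    class-count : ∀ μ → ∑ (λ x → ind (pairMono x ==ᴹ μ)) (withPattern λ') ≡ coeff (kMerged n) μ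
    class-count μ = begin
        ∑ (λ x → ind (pairMono x ==ᴹ μ)) (withPattern λ')
          ≡⟨ ∑-withPattern _ ⟩
        ∑ (λ ψ → ind (pairMono (split ψ) ==ᴹ μ)) Injections
          ≡⟨ ∑-cong Injections (λ ψ∈ → cong ind (Monomial.pairMono-split ψ∈ μ)) ⟩
        ∑ (λ ψ → ind (Mk n size' adj' L' ψ ==ᴹ μ)) Injections
          ≡⟨ sym (coeff-map _ Injections μ) ⟩
        coeff (kMerged n) μ ∎
      where open ≡-Reasoning

mainTheorem10 : (J₁ J₂ : Graph) (L₁ : Fin (size J₁) → Bool) (L₂ : Fin (size J₂) → Bool) (n : ℕ) →
    (ktilde J₁ L₁ n ⊗ ktilde J₂ L₂ n) ≈ kSum J₁ J₂ L₁ L₂ n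
mainTheorem10 J₁ J₂ L₁ L₂ n μ = begin
    coeff (ktilde J₁ L₁ n ⊗ ktilde J₂ L₂ n) μ
      ≡⟨ coeff-⊗ _ _ (injs (size J₁) n) (injs (size J₂) n) μ ⟩
    ∑ weight Pairs
      ≡⟨ ∑-group _≟P_ overlapOf Patterns Pairs weight (pinjs-unique _ _) (overlapOf-∈ _) ⟩
    ∑ (λ λ' → ∑ weight (withPattern λ')) Patterns
      ≡⟨ ∑-cong Patterns (λ λ'∈ → Glue.class-count _ (pinjs-pinj λ'∈) μ) ⟩
    ∑ (λ λ' → coeff (Merge.kMerged J₁ J₂ L₁ L₂ λ' n) μ) Patterns
      ≡⟨ sym (coeff-concatMap _ Patterns μ) ⟩
    coeff (kSum J₁ J₂ L₁ L₂ n) μ ∎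
  where
    open ≡-Reasoning
    open Product J₁ J₂ L₁ L₂ n
    weight : Pair → ℕ
    weight x = ind (pairMono x ==ᴹ μ)
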